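{- For every integer $k \ge 3$, there are infinitely many $B+M_\ell$ graphs $G$ with $\ell = \binom{k}{2}$ and $\mathrm{Kc}(G,k) \ge 2$.
   Context: All graphs are finite and simple. A $k$-coloring of a graph $G$ is a map $c: V(G) \to \{1,\dots,k\}$ with $c(u)\neq c(v)$ for every edge $uv$ (not all colors need be used). A Kempe change swaps two colors $i,j$ on one connected component of the subgraph induced by vertices colored $i$ or $j$. Two $k$-colorings are Kempe equivalent if one is obtained from the other by a finite sequence of Kempe changes (possibly with different color pairs from $\{1,\dots,k\}$); $\mathrm{Kc}(G,k)$ is the number of Kempe equivalence classes of $k$-colorings of $G$. A $B+M_\ell$ graph is a graph obtained from a bipartite graph $B$ with partite sets $S$ and $T$ by adding a matching of $\ell$ new edges, each joining two vertices lying in the same partite set. -}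

module Defs where

open import Data.Nat using (ℕ; _≤_)
open import Data.Fin using (Fin; _≟_)
open import Data.Bool using (Bool; true; false)
open import Data.Product using (Σ; ∃; _×_; _,_; proj₁; proj₂)
open import Data.Sum using (_⊎_)
open import Data.Vec using (Vec; lookup)
open import Relation.Nullary using (¬_; yes; no)
open import Relation.Binary.PropositionalEquality using (_≡_; _≢_)
open import Relation.Binary.Construct.Closure.ReflexiveTransitive using (Star)

record Graph : Set where
  field
    n      : ℕ
    adj    : Fin n → Fin n → Bool
    symm   : ∀ u v → adj u v ≡ adj v u
    irrefl : ∀ v → adj v v ≡ false
open Graph public

Edge : (G : Graph) → Fin (n G) → Fin (n G) → Set
Edge G u v = adj G u v ≡ true

Assignment : Graph → ℕ → Set
Assignment G k = Fin (n G) → Fin k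

IsColoring : (G : Graph) (k : ℕ) → Assignment G k → Set
IsColoring G k c = ∀ u v → Edge G u v → c u ≢ c v

swap : ∀ {k} → Fin k → Fin k → Fin k → Fin k
swap i j x with x ≟ i
... | yes _ = j
... | no _ with x ≟ j
...   | yes _ = i
...   | no _ = x

InPair : ∀ {k} → Fin k → Fin k → Fin k → Set
InPair i j x = (x ≡ i) ⊎ (x ≡ j)

ijEdge : (G : Graph) {k : ℕ} → Assignment G k → Fin k → Fin k → Fin (n G) → Fin (n G) → Set
ijEdge G c i j u v = Edge G u v × InPair i j (c u) × InPair i j (c v)

ijReach : (G : Graph) {k : ℕ} → Assignment G k → Fin k → Fin k → Fin (n G) → Fin (n G) → Set
ijReach G c i j v0 w = Star (ijEdge G c i j) v0 w

KempeChange : (G : Graph) (k : ℕ) → Assignment G k → Assignment G k → Set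
KempeChange G k c c' =
  Σ (Fin k) λ i → Σ (Fin k) λ j → Σ (Fin (n G)) λ v0 →
    InPair i j (c v0) ×
    (∀ w → ijReach G c i j v0 w → c' w ≡ swap i j (c w)) ×
    (∀ w → ¬ ijReach G c i j v0 w → c' w ≡ c w)

KempeEquivalent : (G : Graph) (k : ℕ) → Assignment G k → Assignment G k → Set
KempeEquivalent G k = Star (KempeChange G k)

KcAtLeast2 : Graph → ℕ → Set
KcAtLeast2 G k = Σ (Assignment G k) λ c₁ → Σ (Assignment G k) λ c₂ →
  IsColoring G k c₁ × IsColoring G k c₂ × ¬ KempeEquivalent G k c₁ c₂

-- G is a B+M_ℓ graph: there is a bipartition side : V → Bool (S = true side,
-- T = false side) and a list of ℓ pairs M forming a matching (all 2ℓ endpoints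
-- distinct), each pair an edge of G inside one part, such that every edge of G
-- inside one part is one of these ℓ pairs. (Then B = G minus M is bipartite
-- with parts S, T.)
IsBplusM : Graph → ℕ → Set
IsBplusM G ℓ =
  Σ (Fin (n G) → Bool) λ side →
  Σ (Vec (Fin (n G) × Fin (n G)) ℓ) λ M →
    (∀ e → Edge G (proj₁ (lookup M e)) (proj₂ (lookup M e))) ×
    (∀ e → side (proj₁ (lookup M e)) ≡ side (proj₂ (lookup M e))) ×
    (∀ e e' → (b b' : Bool) → endpoint M e b ≡ endpoint M e' b' → (e ≡ e') × (b ≡ b')) ×
    (∀ u v → Edge G u v → side u ≡ side v →
       ∃ λ e → ((lookup M e ≡ (u , v)) ⊎ (lookup M e ≡ (v , u))))
  where
  endpoint : ∀ {m} → Vec (Fin (n G) × Fin (n G)) m → Fin m → Bool → Fin (n G)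
  endpoint M e true  = proj₁ (lookup M e)
  endpoint M e false = proj₂ (lookup M e)

-- Take K_{k,k} minus a perfect matching on x₁…x_k, y₁…y_k and, for every pair {a,b} of
-- colours, an edge p q with p joined to every y except y_a and q to every y except y_b.
-- In the colouring x_a, y_a ↦ a, p ↦ a, q ↦ b, any two colours a, b span a connected
-- Kempe chain: it runs through y_a and y_b, which the gadget for {a,b} links. So every
-- Kempe change either fixes this colouring or swaps two colours everywhere, and the
-- colourings Kempe equivalent to it are its relabellings. Colouring all x and p alike,
-- all y with a second colour and all q with a third is not a relabelling, so Kc ≥ 2.
-- Since x, p, q form one side, the C(k,2) edges p q are the matching; isolated vertices
-- (on which nothing is constrained) make the graph arbitrarily large.
module Submission where

open import Defs
open import Data.Nat using (ℕ; _≤_)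
open import Data.Nat.Combinatorics using (_C_)
open import Data.Product using (Σ; _×_)

open import Data.Nat using (zero; suc; _+_; s≤s)
open import Data.Nat.Properties using (m≤m+n)
open import Data.Nat.Combinatorics using (nC1≡n; nCk+nC[k+1]≡[n+1]C[k+1])
open import Data.Bool using (Bool; true; false; not; _∨_)
open import Data.Bool.Properties using (∨-comm; ∨-zeroʳ; ¬-not)
open import Data.Empty using (⊥)
open import Data.Unit using (⊤; tt)
open import Data.Fin using (Fin; zero; suc; splitAt; _↑ˡ_; _↑ʳ_; _≟_)
open import Data.Fin.Patterns using (0F; 1F; 2F)
open import Data.Fin.Properties using (splitAt-↑ˡ; splitAt-↑ʳ; suc-injective; +↔⊎)
open import Data.Fin.Permutation using (Permutation′; _⟨$⟩ʳ_; _⟨$⟩ˡ_; inverseˡ; inverseʳ; id; flip; _∘ₚ_; transpose)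
import Data.Fin.Permutation.Components as PC
open import Data.Product using (_,_; proj₁; proj₂; ∃; map₂) renaming (map to ×-map)
open import Data.Sum using (_⊎_; inj₁; inj₂; [_,_]′)
import Data.Sum as Sum
open import Data.Sum.Function.Propositional using (_⊎-↔_)
open import Data.Vec using (Vec; lookup; tabulate)
open import Data.Vec.Properties using (lookup∘tabulate)
open import Function using (_∘_; _↔_; Inverse; Injection)
open import Function.Properties.Inverse using (↔⇒↣)
open import Function.Construct.Composition using (_↔-∘_)
open import Function.Construct.Identity using (↔-id)
open import Relation.Nullary using (¬_; yes; no; does; contradiction)
open import Relation.Nullary.Decidable using (dec-true; dec-false; decidable-stable)
open import Relation.Unary using (Decidable)
open import Relation.Binary.PropositionalEquality
open import Relation.Binary.Construct.Closure.ReflexiveTransitive using (Star; ε; _◅_; _◅◅_; gmap; reverse)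

-- Pairs of colours

triangle : ℕ → ℕ
triangle zero    = 0
triangle (suc k) = k + triangle k

triangle≡C2 : ∀ k → triangle k ≡ k C 2
triangle≡C2 zero    = refl
triangle≡C2 (suc k) = begin
  k + triangle k    ≡⟨ cong₂ _+_ (sym (nC1≡n k)) (triangle≡C2 k) ⟩
  k C 1 + k C 2     ≡⟨ nCk+nC[k+1]≡[n+1]C[k+1] k 1 ⟩
  suc k C 2         ∎
  where open ≡-Reasoning

pair : ∀ k → Fin (triangle k) → Fin k × Fin k
pair (suc k) e with splitAt k e
... | inj₁ a  = zero , suc a
... | inj₂ e′ = suc (proj₁ (pair k e′)) , suc (proj₂ (pair k e′))

pair-distinct : ∀ k e → proj₁ (pair k e) ≢ proj₂ (pair k e)
pair-distinct (suc k) e with splitAt k e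
... | inj₁ a  = λ ()
... | inj₂ e′ = pair-distinct k e′ ∘ suc-injective

pair-↑ˡ : ∀ k (a : Fin k) → pair (suc k) (a ↑ˡ triangle k) ≡ (zero , suc a)
pair-↑ˡ k a rewrite splitAt-↑ˡ k a (triangle k) = refl

pair-↑ʳ : ∀ k (e : Fin (triangle k)) → pair (suc k) (k ↑ʳ e) ≡ ×-map suc suc (pair k e)
pair-↑ʳ k e rewrite splitAt-↑ʳ k (triangle k) e = refl

pair-surjective : ∀ k {a b : Fin k} → a ≢ b →
                  ∃ λ e → pair k e ≡ (a , b) ⊎ pair k e ≡ (b , a)
pair-surjective (suc k) {zero}  {zero}  0≢0 with () ← 0≢0 refl
pair-surjective (suc k) {zero}  {suc b} _ = b ↑ˡ triangle k , inj₁ (pair-↑ˡ k b)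
pair-surjective (suc k) {suc a} {zero}  _ = a ↑ˡ triangle k , inj₂ (pair-↑ˡ k a)
pair-surjective (suc k) {suc a} {suc b} sa≢sb with e , e≡ ← pair-surjective k (sa≢sb ∘ cong suc) =
  k ↑ʳ e , Sum.map (lift e) (lift e) e≡
  where
  lift : ∀ e {c} → pair k e ≡ c → pair (suc k) (k ↑ʳ e) ≡ ×-map suc suc c
  lift e refl = pair-↑ʳ k e

swap≡transpose : ∀ {k} (i j x : Fin k) → swap i j x ≡ PC.transpose i j x
swap≡transpose i j x with x ≟ i
... | yes _ = refl
... | no _ with x ≟ j
...   | yes _ = refl
...   | no _  = refl

swap-fixed-or-moved : ∀ {k} (i j x : Fin k) → swap i j x ≡ x ⊎ (i ≢ j × InPair i j x)
swap-fixed-or-moved i j x with x ≟ i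
... | yes x≡i with j ≟ i
...   | yes j≡i = inj₁ (trans j≡i (sym x≡i))
...   | no j≢i  = inj₂ (j≢i ∘ sym , inj₁ x≡i)
swap-fixed-or-moved i j x | no x≢i with x ≟ j
...   | yes x≡j = inj₂ ((λ i≡j → x≢i (trans x≡j (sym i≡j))) , inj₂ x≡j)
...   | no _    = inj₁ refl

-- Whether w is recoloured need not be decidable: colours having decidable equality suffices.
recolouring-keeps-fixed-point :
  ∀ {A : Set} {k} {R : A → Set} {c c′ : A → Fin k} {f : Fin k → Fin k} →
  (∀ w → R w → c′ w ≡ f (c w)) → (∀ w → ¬ R w → c′ w ≡ c w) →
  ∀ {w} → f (c w) ≡ c w → c′ w ≡ c w
recolouring-keeps-fixed-point recoloured kept {w} fixed =
  decidable-stable (_ ≟ _) λ c′w≢cw → c′w≢cw (kept w (λ r → c′w≢cw (trans (recoloured w r) fixed)))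

Edge-sym : ∀ G {u v} → Edge G u v → Edge G v u
Edge-sym G {u} {v} uv = trans (symm G v u) uv

-- Colourings all of whose Kempe chains are connected

module KempeRigidity
  (G : Graph) {k : ℕ} (c₀ : Assignment G k)
  {P : Fin (n G) → Set} (P? : Decidable P)
  (P-closed : ∀ {u v} → Edge G u v → P u → P v)
  (chains-connected : ∀ {a b} → a ≢ b → ∀ {u v} → P u → P v →
                      InPair a b (c₀ u) → InPair a b (c₀ v) → ijReach G c₀ a b u v)
  where

  IsRelabelling : Assignment G k → Set
  IsRelabelling c = Σ (Permutation′ k) λ π → ∀ {u} → P u → c u ≡ π ⟨$⟩ʳ c₀ u

  reach-closed⁻ : ∀ {c : Assignment G k} {i j u v} → ijReach G c i j u v → P v → P u
  reach-closed⁻ ε                Pv = Pv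
  reach-closed⁻ ((uw , _) ◅ rest) Pv = P-closed (Edge-sym G uw) (reach-closed⁻ rest Pv)

  module _ {c : Assignment G k} (π : Permutation′ k) (c≡πc₀ : ∀ {u} → P u → c u ≡ π ⟨$⟩ʳ c₀ u) where

    relabel-chain : ∀ {a b u v} → ijReach G c₀ a b u v → P u →
                    ijReach G c (π ⟨$⟩ʳ a) (π ⟨$⟩ʳ b) u v
    relabel-chain ε                          _  = ε
    relabel-chain ((uw , ab-u , ab-w) ◅ rest) Pu =
      (uw , relabel Pu ab-u , relabel (P-closed uw Pu) ab-w) ◅ relabel-chain rest (P-closed uw Pu)
      where
      relabel : ∀ {a b u} → P u → InPair a b (c₀ u) → InPair (π ⟨$⟩ʳ a) (π ⟨$⟩ʳ b) (c u)
      relabel Pu = subst (InPair _ _) (sym (c≡πc₀ Pu)) ∘ Sum.map (cong (π ⟨$⟩ʳ_)) (cong (π ⟨$⟩ʳ_))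

    relabelling-chains-connected : ∀ {i j} → i ≢ j → ∀ {u v} → P u → P v →
                                   InPair i j (c u) → InPair i j (c v) → ijReach G c i j u v
    relabelling-chains-connected {i} {j} i≢j {u} {v} Pu Pv ij-u ij-v =
      subst₂ (λ i j → ijReach G c i j u v) (inverseʳ π) (inverseʳ π)
        (relabel-chain (chains-connected a≢b Pu Pv (unrelabel Pu ij-u) (unrelabel Pv ij-v)) Pu)
      where
      a≢b : π ⟨$⟩ˡ i ≢ π ⟨$⟩ˡ j
      a≢b = i≢j ∘ Injection.injective (↔⇒↣ (flip π))
      unrelabel : ∀ {u} → P u → InPair i j (c u) → InPair (π ⟨$⟩ˡ i) (π ⟨$⟩ˡ j) (c₀ u)
      unrelabel {u} Pu = Sum.map unπ unπ
        where
        unπ : ∀ {x} → c u ≡ x → c₀ u ≡ π ⟨$⟩ˡ x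
        unπ cu≡x = trans (sym (inverseˡ π)) (cong (π ⟨$⟩ˡ_) (trans (sym (c≡πc₀ Pu)) cu≡x))

  kempeChange-preserves-IsRelabelling : ∀ {c c′} → KempeChange G k c c′ → IsRelabelling c → IsRelabelling c′
  kempeChange-preserves-IsRelabelling {c} {c′} (i , j , v₀ , ij-v₀ , recoloured , kept) (π , c≡πc₀)
    with P? v₀
  ... | no ¬Pv₀ = π , λ Pu → trans (kept _ (λ r → ¬Pv₀ (reach-closed⁻ r Pu))) (c≡πc₀ Pu)
  ... | yes Pv₀ = π ∘ₚ transpose i j , λ {u} Pu →
    trans (swapped Pu) (trans (cong (swap i j) (c≡πc₀ Pu)) (swap≡transpose i j (π ⟨$⟩ʳ c₀ u)))
    where
    swapped : ∀ {u} → P u → c′ u ≡ swap i j (c u)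
    swapped {u} Pu with swap-fixed-or-moved i j (c u)
    ... | inj₁ fixed          = trans (recolouring-keeps-fixed-point {f = swap i j} recoloured kept fixed) (sym fixed)
    ... | inj₂ (i≢j , ij-u)   = recoloured u (relabelling-chains-connected π c≡πc₀ i≢j Pv₀ Pu ij-v₀ ij-u)

  kempeEquivalent-preserves-IsRelabelling : ∀ {c c′} → KempeEquivalent G k c c′ → IsRelabelling c → IsRelabelling c′
  kempeEquivalent-preserves-IsRelabelling ε        r = r
  kempeEquivalent-preserves-IsRelabelling (kc ◅ ks) r =
    kempeEquivalent-preserves-IsRelabelling ks (kempeChange-preserves-IsRelabelling kc r)

  ¬IsRelabelling⇒¬KempeEquivalent : ∀ {c} → ¬ IsRelabelling c → ¬ KempeEquivalent G k c₀ c
  ¬IsRelabelling⇒¬KempeEquivalent ¬rel c₀~c =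
    ¬rel (kempeEquivalent-preserves-IsRelabelling c₀~c (id , λ _ → refl))

-- The graphs

module Construction (k′ N : ℕ) where

  k : ℕ
  k = 3 + k′

  d : ℕ
  d = triangle k

  V : Set
  V = Fin N ⊎ Fin k ⊎ Fin k ⊎ Fin d ⊎ Fin d

  pattern pad t = inj₁ t
  pattern x a   = inj₂ (inj₁ a)
  pattern y a   = inj₂ (inj₂ (inj₁ a))
  pattern p e   = inj₂ (inj₂ (inj₂ (inj₁ e)))
  pattern q e   = inj₂ (inj₂ (inj₂ (inj₂ e)))

  private
    variable
      a b : Fin k
      e   : Fin d
      s t : V

  data Arc : V → V → Set where
    x→y : a ≢ b → Arc (x a) (y b)
    p→y : b ≢ proj₁ (pair k e) → Arc (p e) (y b)
    q→y : b ≢ proj₂ (pair k e) → Arc (q e) (y b)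
    p→q : Arc (p e) (q e)

  arc : V → V → Bool
  arc (x a) (y b)  = not (does (a ≟ b))
  arc (p e) (y b)  = not (does (b ≟ proj₁ (pair k e)))
  arc (q e) (y b)  = not (does (b ≟ proj₂ (pair k e)))
  arc (p e) (q e′) = does (e ≟ e′)
  arc _     _      = false

  arc-sound : ∀ s t → arc s t ≡ true → Arc s t
  arc-sound (x a) (y b)  _ with a ≟ b
  ... | no a≢b = x→y a≢b
  arc-sound (p e) (y b)  _ with b ≟ proj₁ (pair k e)
  ... | no ne = p→y ne
  arc-sound (q e) (y b)  _ with b ≟ proj₂ (pair k e)
  ... | no ne = q→y ne
  arc-sound (p e) (q e′) _ with e ≟ e′
  ... | yes refl = p→q

  arc-complete : Arc s t → arc s t ≡ true
  arc-complete (x→y {a} {b} a≢b)  = cong not (dec-false (a ≟ b) a≢b)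
  arc-complete (p→y {b} ne)       = cong not (dec-false (b ≟ _) ne)
  arc-complete (q→y {b} ne)       = cong not (dec-false (b ≟ _) ne)
  arc-complete (p→q {e})          = dec-true (e ≟ e) refl

  ¬Arc-refl : ¬ Arc s s
  ¬Arc-refl ()

  Adjacent : V → V → Set
  Adjacent s t = Arc s t ⊎ Arc t s

  adjacent : V → V → Bool
  adjacent s t = arc s t ∨ arc t s

  adjacent-sound : ∀ s t → adjacent s t ≡ true → Adjacent s t
  adjacent-sound s t st with arc s t in arc-st
  ... | true  = inj₁ (arc-sound s t arc-st)
  ... | false = inj₂ (arc-sound t s st)

  adjacent-complete : Adjacent s t → adjacent s t ≡ true
  adjacent-complete {s} {t} (inj₁ st) rewrite arc-complete st = refl
  adjacent-complete {s} {t} (inj₂ ts) rewrite arc-complete ts = ∨-zeroʳ (arc s t)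

  adjacent-irrefl : ∀ s → adjacent s s ≡ false
  adjacent-irrefl s = cong₂ _∨_ arc-ss arc-ss
    where
    arc-ss : arc s s ≡ false
    arc-ss = ¬-not (¬Arc-refl ∘ arc-sound s s)

  encoding : Fin (N + (k + (k + (d + d)))) ↔ V
  encoding = then (then (then +↔⊎))
    where
    then : ∀ {m n} {A : Set} → Fin n ↔ A → Fin (m + n) ↔ (Fin m ⊎ A)
    then {m} e = (↔-id (Fin m) ⊎-↔ e) ↔-∘ +↔⊎

  open Inverse encoding using (to; from) renaming (strictlyInverseˡ to to∘from; strictlyInverseʳ to from∘to)

  graph : Graph
  graph = record
    { n      = N + (k + (k + (d + d)))
    ; adj    = λ u v → adjacent (to u) (to v)
    ; symm   = λ u v → ∨-comm (arc (to u) (to v)) (arc (to v) (to u))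
    ; irrefl = adjacent-irrefl ∘ to
    }

  edge : Adjacent s t → Edge graph (from s) (from t)
  edge {s} {t} st rewrite to∘from s | to∘from t = adjacent-complete st

  adjacent-of-edge : ∀ {u v} → Edge graph u v → Adjacent (to u) (to v)
  adjacent-of-edge = adjacent-sound _ _

  isColoring : (col : V → Fin k) → (∀ {s t} → Arc s t → col s ≢ col t) → IsColoring graph k (col ∘ to)
  isColoring col proper u v uv with adjacent-of-edge uv
  ... | inj₁ arc-uv = proper arc-uv
  ... | inj₂ arc-vu = proper arc-vu ∘ sym

  col₁ : V → Fin k
  col₁ (pad _) = 0F
  col₁ (x a)   = a
  col₁ (y a)   = a
  col₁ (p e)   = proj₁ (pair k e)
  col₁ (q e)   = proj₂ (pair k e)

  col₂ : V → Fin k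
  col₂ (y _) = 1F
  col₂ (q _) = 2F
  col₂ _     = 0F

  col₁-proper : Arc s t → col₁ s ≢ col₁ t
  col₁-proper (x→y a≢b) = a≢b
  col₁-proper (p→y ne)  = ne ∘ sym
  col₁-proper (q→y ne)  = ne ∘ sym
  col₁-proper (p→q {e}) = pair-distinct k e

  col₂-proper : Arc s t → col₂ s ≢ col₂ t
  col₂-proper (x→y _) ()
  col₂-proper (p→y _) ()
  col₂-proper (q→y _) ()
  col₂-proper p→q     ()

  c₁ c₂ : Assignment graph k
  c₁ = col₁ ∘ to
  c₂ = col₂ ∘ to

  Core : V → Set
  Core (pad _)  = ⊥
  Core (inj₂ _) = ⊤

  core? : Decidable Core
  core? (pad _)  = no λ ()
  core? (inj₂ _) = yes tt

  arc-core : Arc s t → Core s × Core t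
  arc-core (x→y _) = tt , tt
  arc-core (p→y _) = tt , tt
  arc-core (q→y _) = tt , tt
  arc-core p→q     = tt , tt

  edge-core : ∀ {u v} → Edge graph u v → Core (to u) → Core (to v)
  edge-core uv _ = [ proj₂ ∘ arc-core , proj₁ ∘ arc-core ]′ (adjacent-of-edge uv)

  Chain : Fin k → Fin k → V → V → Set
  Chain a b s t = Adjacent s t × InPair a b (col₁ s) × InPair a b (col₁ t)

  chain-sym : Chain a b s t → Chain a b t s
  chain-sym (st , a-s , a-t) = Sum.swap st , a-t , a-s

  module _ {a b : Fin k} (a≢b : a ≢ b) where

    through-gadget : ∀ e {a′ b′} → pair k e ≡ (a′ , b′) → InPair a b a′ → InPair a b b′ →
                     Star (Chain a b) (y b′) (y a′)
    through-gadget e refl ab-a′ ab-b′ =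
      (inj₂ (p→y {e = e} (pair-distinct k e ∘ sym)) , ab-b′ , ab-a′) ◅
      (inj₁ (p→q {e = e}) , ab-a′ , ab-b′) ◅
      (inj₁ (q→y {e = e} (pair-distinct k e)) , ab-b′ , ab-a′) ◅ ε

    y-linked : Star (Chain a b) (y b) (y a)
    y-linked with pair-surjective k a≢b
    ... | e , inj₁ e≡ab = through-gadget e e≡ab (inj₁ refl) (inj₂ refl)
    ... | e , inj₂ e≡ba = reverse chain-sym (through-gadget e e≡ba (inj₂ refl) (inj₁ refl))

    via-y : ∀ s → (∀ {c} → col₁ s ≢ c → Arc s (y c)) → InPair a b (col₁ s) → Star (Chain a b) s (y a)
    via-y s arc-y (inj₁ s≡a) =
      (inj₁ (arc-y (a≢b ∘ trans (sym s≡a))) , inj₁ s≡a , inj₂ refl) ◅ y-linked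
    via-y s arc-y (inj₂ s≡b) =
      (inj₁ (arc-y (λ s≡a → a≢b (trans (sym s≡a) s≡b))) , inj₂ s≡b , inj₁ refl) ◅ ε

    chain-to-y : ∀ s → Core s → InPair a b (col₁ s) → Star (Chain a b) s (y a)
    chain-to-y (x c) _ = via-y (x c) x→y
    chain-to-y (y c) _ (inj₁ refl) = ε
    chain-to-y (y c) _ (inj₂ refl) = y-linked
    chain-to-y (p e) _ = via-y (p e) (λ ne → p→y (ne ∘ sym))
    chain-to-y (q e) _ = via-y (q e) (λ ne → q→y (ne ∘ sym))

    core-chain : ∀ s t → Core s → Core t → InPair a b (col₁ s) → InPair a b (col₁ t) →
                 Star (Chain a b) s t
    core-chain s t core-s core-t ab-s ab-t =
      chain-to-y s core-s ab-s ◅◅ reverse chain-sym (chain-to-y t core-t ab-t)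

  chain-ijEdge : Chain a b s t → ijEdge graph c₁ a b (from s) (from t)
  chain-ijEdge {a} {b} {s} {t} (st , ab-s , ab-t) =
    edge st , subst (InPair a b ∘ col₁) (sym (to∘from s)) ab-s , subst (InPair a b ∘ col₁) (sym (to∘from t)) ab-t

  c₁-chains-connected : a ≢ b → ∀ {u v} → Core (to u) → Core (to v) →
                        InPair a b (c₁ u) → InPair a b (c₁ v) → ijReach graph c₁ a b u v
  c₁-chains-connected {a} {b} a≢b {u} {v} core-u core-v ab-u ab-v =
    subst₂ (ijReach graph c₁ a b) (from∘to u) (from∘to v)
      (gmap from chain-ijEdge (core-chain a≢b (to u) (to v) core-u core-v ab-u ab-v))

  open KempeRigidity graph c₁ (core? ∘ to) edge-core c₁-chains-connected

  ¬IsRelabelling-c₂ : ¬ IsRelabelling c₂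
  ¬IsRelabelling-c₂ (π , c≡πc₁) = contradiction (Injection.injective (↔⇒↣ π) (trans (πx 0F) (sym (πx 1F)))) λ ()
    where
    πx : ∀ a → π ⟨$⟩ʳ a ≡ 0F
    πx a = begin
      π ⟨$⟩ʳ a                ≡⟨ cong (λ s → π ⟨$⟩ʳ col₁ s) (to∘from (x a)) ⟨
      π ⟨$⟩ʳ c₁ (from (x a))  ≡⟨ c≡πc₁ (subst Core (sym (to∘from (x a))) tt) ⟨
      c₂ (from (x a))         ≡⟨ cong col₂ (to∘from (x a)) ⟩
      0F                      ∎
      where open ≡-Reasoning

  c₁≁c₂ : ¬ KempeEquivalent graph k c₁ c₂
  c₁≁c₂ = ¬IsRelabelling⇒¬KempeEquivalent ¬IsRelabelling-c₂

  inS : V → Bool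
  inS (y _) = false
  inS _     = true

  side : Fin (n graph) → Bool
  side = inS ∘ to

  same-side-arc : Arc s t → inS s ≡ inS t → ∃ λ e → s ≡ p e × t ≡ q e
  same-side-arc (p→q {e}) _ = e , refl , refl

  end : Fin d → Bool → V
  end e true  = p e
  end e false = q e

  end-injective : ∀ {e e′} b b′ → end e b ≡ end e′ b′ → e ≡ e′ × b ≡ b′
  end-injective true  true  refl = refl , refl
  end-injective false false refl = refl , refl

  matching : Vec (Fin (n graph) × Fin (n graph)) d
  matching = tabulate λ e → from (p e) , from (q e)

  lookup-matching : ∀ e → lookup matching e ≡ (from (p e) , from (q e))
  lookup-matching = lookup∘tabulate _

  matching-end : Fin d → Bool → Fin (n graph)
  matching-end e true  = proj₁ (lookup matching e)
  matching-end e false = proj₂ (lookup matching e)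

  matching-end≡ : ∀ e b → matching-end e b ≡ from (end e b)
  matching-end≡ e true  = cong proj₁ (lookup-matching e)
  matching-end≡ e false = cong proj₂ (lookup-matching e)

  matching-end-injective : ∀ e e′ b b′ → matching-end e b ≡ matching-end e′ b′ → e ≡ e′ × b ≡ b′
  matching-end-injective e e′ b b′ same = end-injective b b′ (begin
    end e b                ≡⟨ to∘from (end e b) ⟨
    to (from (end e b))    ≡⟨ cong to (trans (sym (matching-end≡ e b)) (trans same (matching-end≡ e′ b′))) ⟩
    to (from (end e′ b′))  ≡⟨ to∘from (end e′ b′) ⟩
    end e′ b′              ∎)
    where open ≡-Reasoning

  matching-edge : ∀ e → Edge graph (proj₁ (lookup matching e)) (proj₂ (lookup matching e))
  matching-edge e rewrite lookup-matching e = edge (inj₁ p→q)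

  matching-same-side : ∀ e → side (proj₁ (lookup matching e)) ≡ side (proj₂ (lookup matching e))
  matching-same-side e rewrite lookup-matching e | to∘from (p e) | to∘from (q e) = refl

  from-to-≡ : ∀ {u s} → to u ≡ s → from s ≡ u
  from-to-≡ {u} refl = from∘to u

  same-side-edge-matched : ∀ {u v} → Arc (to u) (to v) → side u ≡ side v →
                           ∃ λ e → lookup matching e ≡ (u , v)
  same-side-edge-matched uv same with e , u≡pe , v≡qe ← same-side-arc uv same =
    e , trans (lookup-matching e) (cong₂ _,_ (from-to-≡ u≡pe) (from-to-≡ v≡qe))

  matching-covers : ∀ u v → Edge graph u v → side u ≡ side v →
                    ∃ λ e → (lookup matching e ≡ (u , v)) ⊎ (lookup matching e ≡ (v , u))
  matching-covers u v uv same with adjacent-of-edge uv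
  ... | inj₁ arc-uv = map₂ inj₁ (same-side-edge-matched arc-uv same)
  ... | inj₂ arc-vu = map₂ inj₂ (same-side-edge-matched arc-vu (sym same))

  isBplusM : IsBplusM graph d
  isBplusM = side , matching , matching-edge , matching-same-side ,
    (λ where e e′ true  true  → matching-end-injective e e′ true  true
             e e′ true  false → matching-end-injective e e′ true  false
             e e′ false true  → matching-end-injective e e′ false true
             e e′ false false → matching-end-injective e e′ false false) ,
    matching-covers

proposition3 : (k : ℕ) → 3 ≤ k → (N : ℕ) →
    Σ Graph λ G → (N ≤ n G) × IsBplusM G (k C 2) × KcAtLeast2 G k
proposition3 (suc (suc (suc k′))) (s≤s (s≤s (s≤s _))) N =
  graph ,
  m≤m+n N _ ,
  subst (IsBplusM graph) (triangle≡C2 k) isBplusM ,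
  c₁ , c₂ , isColoring col₁ col₁-proper , isColoring col₂ col₂-proper , c₁≁c₂
  where open Construction k′ N
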